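{- Let $G$ be a group with subgroups $N \trianglelefteq H \leq G$ such that $H/N$ is virtually free non-abelian. Let $K$ be a subgroup with $N \le K \le H$ such that $F = K/N$ is a free non-abelian normal subgroup of $H/N$ of finite index $m$. Suppose that $H$ is $n$-pure in $G$ for some prime $n > m$, and suppose further that for every prime $n > m$ for which $H$ is $n$-pure in $G$ there are elements $a_\ell \in H \setminus N$, $\ell < \omega$, such that $\ell_1 \neq \ell_2$ implies $a_{\ell_1}^{ -1} a_{\ell_2} N \notin \{ x^nN\, y^nN : x, y \in H\}$. Then for every prime $n > m$ for which $H$ is $n$-pure in $G$, and with $k = 1$, the following hold: (a) for every $a \in H$, the set $X_a := \{x \in G : x^n = a\}$ satisfies $X_a \subseteq H$ and $|X_a/N| \leq k$; (b) there are $a_\ell \in H \setminus N$, for $\ell < \omega$, such that $\ell_1 \neq \ell_2$ implies $a_{\ell_1}^{ -1} a_{\ell_2} N \notin \{ x^nN\, y^nN : x, y \in H\}$.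
   Context: For $H \le G$ and $2 \le n<\omega$, $H$ is $n$-pure in $G$ if for every $a \in H$ and every $b \in G$ with $b^n = a$ we have $b \in H$. For a subset $Y\subseteq H$, $Y/N$ denotes $\{yN : y\in Y\}$. -}

module Defs where

open import Level using (Level; _⊔_) renaming (suc to lsuc)
open import Algebra.Bundles using (Group)
open import Data.Nat using (ℕ; zero; suc)
open import Data.Bool using (Bool; true; false; not)
open import Data.Fin using (Fin)
open import Data.List using (List; []; _∷_)
open import Data.Product using (Σ; ∃; ∃-syntax; _×_; _,_)
open import Data.Unit using (⊤)
open import Relation.Nullary using (¬_)
open import Relation.Binary.PropositionalEquality using (_≡_; _≢_)

module _ {c ℓ : Level} (G : Group c ℓ) where
  open Group G

  private
    variable
      p : Level

  pow : Carrier → ℕ → Carrier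
  pow x zero    = ε
  pow x (suc n) = x ∙ pow x n

  record IsSubgroup (S : Carrier → Set p) : Set (c ⊔ ℓ ⊔ p) where
    field
      resp  : ∀ {x y} → x ≈ y → S x → S y
      ε∈    : S ε
      ∙∈    : ∀ {x y} → S x → S y → S (x ∙ y)
      ⁻¹∈   : ∀ {x} → S x → S (x ⁻¹)

  _⊆_ : ∀ {q r} → (A : Carrier → Set q) (B : Carrier → Set r) → Set (c ⊔ q ⊔ r)
  A ⊆ B = ∀ {x} → A x → B x

  NormalIn : (N H : Carrier → Set p) → Set (c ⊔ p)
  NormalIn N H = ∀ {h x} → H h → N x → N ((h ∙ x) ∙ (h ⁻¹))

  -- Congruence modulo N: xN = yN, i.e. x⁻¹ y ∈ N.
  _∼[_]_ : Carrier → (Carrier → Set p) → Carrier → Set p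
  x ∼[ N ] y = N ((x ⁻¹) ∙ y)

  IsPure : ℕ → (Carrier → Set p) → Set (c ⊔ ℓ ⊔ p)
  IsPure n H = ∀ (a b : Carrier) → H a → pow b n ≈ a → H b

  -- Words in letters b^{±1}: (b , true) means b, (b , false) means b⁻¹.
  letter : Carrier × Bool → Carrier
  letter (b , true)  = b
  letter (b , false) = b ⁻¹

  eval : List (Carrier × Bool) → Carrier
  eval []       = ε
  eval (x ∷ w)  = letter x ∙ eval w

  Letters : (Carrier → Set p) → List (Carrier × Bool) → Set p
  Letters B []            = Level.Lift _ ⊤
  Letters B ((b , _) ∷ w) = B b × Letters B w

  -- reduced in the quotient G/N: no adjacent b^{s} b'^{-s} with bN = b'N
  ReducedMod : (Carrier → Set p) → List (Carrier × Bool) → Set p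
  ReducedMod N []                         = Level.Lift _ ⊤
  ReducedMod N (_ ∷ [])                   = Level.Lift _ ⊤
  ReducedMod N ((b , s) ∷ (b' , s') ∷ w) =
    ¬ (s' ≡ not s × b ∼[ N ] b') × ReducedMod N ((b' , s') ∷ w)

  -- K/N is a free group with basis B/N (B ⊆ K):
  -- every element of K/N is (the class of) a reduced word in B/N, and
  -- no nonempty reduced word represents the identity of K/N.
  IsFreeModOn : (N K B : Carrier → Set p) → Set (c ⊔ p)
  IsFreeModOn N K B =
      B ⊆ K
    × (∀ {k} → K k → ∃[ w ] (Letters B w × ReducedMod N w × k ∼[ N ] eval w))
    × (∀ (x : Carrier × Bool) (w : List (Carrier × Bool)) →
         Letters B (x ∷ w) → ReducedMod N (x ∷ w) → ¬ N (eval (x ∷ w)))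

  NonAbelianMod : (N K : Carrier → Set p) → Set (c ⊔ p)
  NonAbelianMod N K = ∃[ x ] ∃[ y ] (K x × K y × ¬ ((x ∙ y) ∼[ N ] (y ∙ x)))

  FreeNonAbelianMod : (N K : Carrier → Set p) → Set (c ⊔ lsuc p)
  FreeNonAbelianMod {p} N K =
    (∃[ B ] IsFreeModOn N K B) × NonAbelianMod N K

  -- K/N has index m in H/N (equivalently K has index m in H, as N ⊆ K):
  -- there are m coset representatives h_i ∈ H such that every h ∈ H lies
  -- in some h_i K, and the cosets h_i K are pairwise distinct.
  IndexIn : (K H : Carrier → Set p) → ℕ → Set (c ⊔ p)
  IndexIn K H m = Σ (Fin m → Carrier) λ r → ((∀ (i : Fin m) → H (r i))
    × (∀ {h} → H h → Σ (Fin m) λ i → (r i ∼[ K ] h))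
    × (∀ (i j : Fin m) → r i ∼[ K ] r j → i ≡ j))

  VirtuallyFreeNonAbelianMod : (N H : Carrier → Set p) → Set (c ⊔ ℓ ⊔ lsuc p)
  VirtuallyFreeNonAbelianMod {p} N H =
    ∃[ K' ] (IsSubgroup K' × N ⊆ K' × K' ⊆ H
             × FreeNonAbelianMod N K' × ∃[ m ] IndexIn K' H m)

  -- |X/N| ≤ k : among any k+1 elements of X two are congruent mod N.
  CardMod≤ : ∀ {q} → (N : Carrier → Set p) (X : Carrier → Set q) → ℕ → Set (c ⊔ p ⊔ q)
  CardMod≤ N X k = ∀ (f : Fin (suc k) → Carrier) → (∀ i → X (f i)) →
    ∃[ i ] ∃[ j ] (i ≢ j × f i ∼[ N ] f j)

  Roots : ℕ → Carrier → Carrier → Set ℓ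
  Roots n a x = pow x n ≈ a

  SequenceProperty : ℕ → (N H : Carrier → Set p) → Set (c ⊔ p)
  SequenceProperty n N H = Σ (ℕ → Carrier) λ a → ((∀ (i : ℕ) → H (a i) × ¬ N (a i))
    × (∀ (i j : ℕ) → i ≢ j →
         ¬ (Σ Carrier λ x → Σ Carrier λ y → (H x × H y ×
              (((a i) ⁻¹ ∙ a j) ∼[ N ] (pow x n ∙ pow y n))))))

-- Here X_a ⊆ H is purity and (b) is assumed; the content is |X_a/N| ≤ 1, i.e. n-th roots in H
-- are unique modulo N. Since K has m cosets in H, every x ∈ H has a power x^d ∈ K with 0 < d ≤ m,
-- so two roots x, y of a have powers x^M, y^M ∈ K for some M coprime to the prime n > m. In the
-- free group K/N, n-th roots are unique: write an element as d⁻¹ c d with c cyclically reduced;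
-- then d⁻¹ cⁿ d is the reduced word of its n-th power, and reduced words are unique. Hence
-- x^M ≡ y^M mod N, and a Bézout identity for n and M combines this with x^n = y^n into x ≡ y.
module Submission where

open import Defs
open import Level using (Level)
open import Algebra.Bundles using (Group)
open import Data.Nat using (ℕ; _<_)
open import Data.Nat.Primality using (Prime)
open import Data.Product using (∃-syntax; _×_)

open import Level using (_⊔_; Lift; lift)
open import Data.Nat using (zero; suc; _+_; _*_; _∸_; _≤_; s≤s; >-nonZero)
import Data.Nat.Properties as ℕ
open import Data.Nat.Divisibility using (∣-trans)
open import Data.Nat.Coprimality using (Coprime; coprime-divisor; coprime-Bézout; prime⇒coprime)
open import Data.Nat.GCD using (module Bézout)
open import Data.Bool using (Bool; true; false; not)
import Data.Bool.Properties as Bool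
import Data.Fin as Fin
open import Data.Fin.Properties using (pigeonhole; toℕ<n)
open import Data.List using (List; []; _∷_; _++_; _∷ʳ_; length; initLast; _∷ʳ′_)
import Data.List.Properties as List
open import Data.List.Relation.Unary.All using (All; []; _∷_)
import Data.List.Relation.Unary.All.Properties as All
open import Data.List.Relation.Binary.Pointwise as Pointwise using (Pointwise; []; _∷_; Pointwise-length)
open import Data.Product using (_,_; proj₁; proj₂)
open import Data.Empty using (⊥-elim)
open import Data.Unit using (⊤; tt)
open import Relation.Nullary using (¬_; Dec; yes; no)
open import Relation.Nullary.Decidable using (_×-dec_)
open import Function using (_∘_)
open import Relation.Binary.PropositionalEquality as ≡ using (_≡_; _≢_)
import Algebra.Properties.Group as GroupProperties

coprime-* : ∀ {m a b} → Coprime m a → Coprime m b → Coprime m (a * b)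
coprime-* ca cb (d∣m , d∣ab) =
  cb (d∣m , coprime-divisor (λ (e∣d , e∣a) → ca (∣-trans e∣d d∣m , e∣a)) d∣ab)

length-∷ʳ : ∀ {a} {A : Set a} (xs : List A) x → length (xs ∷ʳ x) ≡ suc (length xs)
length-∷ʳ xs x = ≡.trans (List.length-++ xs) (ℕ.+-comm (length xs) 1)

module Powers {c ℓ : Level} (G : Group c ℓ) where
  open Group G
  open import Relation.Binary.Reasoning.Setoid setoid

  pow-cong : ∀ {x y} k → x ≈ y → pow G x k ≈ pow G y k
  pow-cong zero    _   = refl
  pow-cong (suc k) x≈y = ∙-cong x≈y (pow-cong k x≈y)

  pow-+ : ∀ x i j → pow G x (i + j) ≈ pow G x i ∙ pow G x j
  pow-+ x zero    j = sym (identityˡ _)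
  pow-+ x (suc i) j = trans (∙-congˡ (pow-+ x i j)) (sym (assoc _ _ _))

  pow-* : ∀ x i j → pow G x (i * j) ≈ pow G (pow G x j) i
  pow-* x zero    j = refl
  pow-* x (suc i) j = trans (pow-+ x j (i * j)) (∙-congˡ (pow-* x i j))

  pow-pow-comm : ∀ x i j → pow G (pow G x i) j ≈ pow G (pow G x j) i
  pow-pow-comm x i j =
    trans (sym (pow-* x j i)) (trans (reflexive (≡.cong (pow G x) (ℕ.*-comm j i))) (pow-* x i j))

  pow-conjugate : ∀ h g k → pow G (h ⁻¹ ∙ (g ∙ h)) k ≈ h ⁻¹ ∙ (pow G g k ∙ h)
  pow-conjugate h g zero = sym (trans (∙-congˡ (identityˡ _)) (inverseˡ _))
  pow-conjugate h g (suc k) = begin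
    (h ⁻¹ ∙ (g ∙ h)) ∙ pow G (h ⁻¹ ∙ (g ∙ h)) k ≈⟨ ∙-congˡ (pow-conjugate h g k) ⟩
    (h ⁻¹ ∙ (g ∙ h)) ∙ (h ⁻¹ ∙ (pow G g k ∙ h)) ≈⟨ assoc _ _ _ ⟩
    h ⁻¹ ∙ ((g ∙ h) ∙ (h ⁻¹ ∙ (pow G g k ∙ h))) ≈⟨ ∙-congˡ (assoc _ _ _) ⟩
    h ⁻¹ ∙ (g ∙ (h ∙ (h ⁻¹ ∙ (pow G g k ∙ h)))) ≈⟨ ∙-congˡ (∙-congˡ (\\-leftDividesˡ h _)) ⟩
    h ⁻¹ ∙ (g ∙ (pow G g k ∙ h))               ≈⟨ ∙-congˡ (sym (assoc _ _ _)) ⟩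
    h ⁻¹ ∙ ((g ∙ pow G g k) ∙ h)               ∎
    where open GroupProperties G using (\\-leftDividesˡ)

  pow∈ : ∀ {p} {S : Carrier → Set p} → IsSubgroup G S → ∀ {x} k → S x → S (pow G x k)
  pow∈ S-sub zero    _  = IsSubgroup.ε∈ S-sub
  pow∈ S-sub (suc k) Sx = IsSubgroup.∙∈ S-sub Sx (pow∈ S-sub k Sx)

module Congruence {c ℓ p : Level} (G : Group c ℓ)
  (N : Group.Carrier G → Set p) (N-sub : IsSubgroup G N) where
  open Group G
  open GroupProperties G
  open Powers G
  open IsSubgroup N-sub
  open import Relation.Binary.Reasoning.Setoid setoid

  infix 4 _∼_
  _∼_ : Carrier → Carrier → Set p
  x ∼ y = N (x ⁻¹ ∙ y)

  ∼-refl : ∀ {x} → x ∼ x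
  ∼-refl = resp (sym (inverseˡ _)) ε∈

  ∼-sym : ∀ {x y} → x ∼ y → y ∼ x
  ∼-sym x∼y = resp (trans (⁻¹-anti-homo-∙ _ _) (∙-congˡ (⁻¹-involutive _))) (⁻¹∈ x∼y)

  ∼-trans : ∀ {x y z} → x ∼ y → y ∼ z → x ∼ z
  ∼-trans {x} {y} {z} x∼y y∼z = resp (begin
    (x ⁻¹ ∙ y) ∙ (y ⁻¹ ∙ z) ≈⟨ assoc _ _ _ ⟩
    x ⁻¹ ∙ (y ∙ (y ⁻¹ ∙ z)) ≈⟨ ∙-congˡ (\\-leftDividesˡ y z) ⟩
    x ⁻¹ ∙ z                ∎) (∙∈ x∼y y∼z)

  ∼-resp-≈ : ∀ {x y x′ y′} → x ≈ x′ → y ≈ y′ → x ∼ y → x′ ∼ y′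
  ∼-resp-≈ x≈x′ y≈y′ = resp (∙-cong (⁻¹-cong x≈x′) y≈y′)

  ≈⇒∼ : ∀ {x y} → x ≈ y → x ∼ y
  ≈⇒∼ x≈y = ∼-resp-≈ refl x≈y ∼-refl

  ∼-congˡ : ∀ g {x y} → x ∼ y → g ∙ x ∼ g ∙ y
  ∼-congˡ g {x} {y} = resp (begin
    x ⁻¹ ∙ y                  ≈⟨ ∙-congˡ (\\-leftDividesʳ g y) ⟨
    x ⁻¹ ∙ (g ⁻¹ ∙ (g ∙ y))   ≈⟨ assoc _ _ _ ⟨
    (x ⁻¹ ∙ g ⁻¹) ∙ (g ∙ y)   ≈⟨ ∙-congʳ (⁻¹-anti-homo-∙ g x) ⟨
    (g ∙ x) ⁻¹ ∙ (g ∙ y)      ∎)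

  ε∼⇒∈ : ∀ {x} → ε ∼ x → N x
  ε∼⇒∈ = resp (trans (∙-congʳ ε⁻¹≈ε) (identityˡ _))

  ∼ε⇒∈ : ∀ {x} → x ∼ ε → N x
  ∼ε⇒∈ x∼ε = resp (⁻¹-involutive _) (⁻¹∈ (resp (identityʳ _) x∼ε))

  pow-∼⇒pow-∸∈ : ∀ {x} i j → i ≤ j → pow G x i ∼ pow G x j → N (pow G x (j ∸ i))
  pow-∼⇒pow-∸∈ {x} i j i≤j = resp (begin
    pow G x i ⁻¹ ∙ pow G x j                   ≈⟨ ∙-congˡ (reflexive (≡.cong (pow G x) (ℕ.m+[n∸m]≡n i≤j))) ⟨
    pow G x i ⁻¹ ∙ pow G x (i + (j ∸ i))       ≈⟨ ∙-congˡ (pow-+ x i (j ∸ i)) ⟩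
    pow G x i ⁻¹ ∙ (pow G x i ∙ pow G x (j ∸ i)) ≈⟨ \\-leftDividesʳ _ _ ⟩
    pow G x (j ∸ i)                            ∎)

  cardMod≤1 : ∀ {q} {X : Carrier → Set q} → (∀ {x y} → X x → X y → x ∼ y) → CardMod≤ G N X 1
  cardMod≤1 X-congruent f Xf = Fin.zero , Fin.suc Fin.zero , (λ ()) , X-congruent (Xf Fin.zero) (Xf (Fin.suc Fin.zero))

  module Normal (H : Carrier → Set p) (H-sub : IsSubgroup G H) (normal : NormalIn G N H) where
    private module H = IsSubgroup H-sub

    ∼-congʳ : ∀ {x y} g → H g → x ∼ y → x ∙ g ∼ y ∙ g
    ∼-congʳ {x} {y} g Hg x∼y = resp (begin
      (g ⁻¹ ∙ (x ⁻¹ ∙ y)) ∙ g ⁻¹ ⁻¹ ≈⟨ ∙-congˡ (⁻¹-involutive _) ⟩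
      (g ⁻¹ ∙ (x ⁻¹ ∙ y)) ∙ g       ≈⟨ ∙-congʳ (assoc _ _ _) ⟨
      ((g ⁻¹ ∙ x ⁻¹) ∙ y) ∙ g       ≈⟨ assoc _ _ _ ⟩
      (g ⁻¹ ∙ x ⁻¹) ∙ (y ∙ g)       ≈⟨ ∙-congʳ (⁻¹-anti-homo-∙ _ _) ⟨
      (x ∙ g) ⁻¹ ∙ (y ∙ g)          ∎) (normal (H.⁻¹∈ Hg) x∼y)

    ∼-∙ : ∀ {x y x′ y′} → H x′ → x ∼ y → x′ ∼ y′ → x ∙ x′ ∼ y ∙ y′
    ∼-∙ Hx′ x∼y x′∼y′ = ∼-trans (∼-congʳ _ Hx′ x∼y) (∼-congˡ _ x′∼y′)

    ∼-⁻¹ : ∀ {x y} → H x → x ∼ y → x ⁻¹ ∼ y ⁻¹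
    ∼-⁻¹ {x} {y} Hx x∼y = resp (begin
      (x ∙ (x ⁻¹ ∙ y) ⁻¹) ∙ x ⁻¹      ≈⟨ ∙-congʳ (∙-congˡ (⁻¹-anti-homo-∙ _ _)) ⟩
      (x ∙ (y ⁻¹ ∙ x ⁻¹ ⁻¹)) ∙ x ⁻¹   ≈⟨ ∙-congʳ (∙-congˡ (∙-congˡ (⁻¹-involutive _))) ⟩
      (x ∙ (y ⁻¹ ∙ x)) ∙ x ⁻¹         ≈⟨ assoc _ _ _ ⟩
      x ∙ ((y ⁻¹ ∙ x) ∙ x ⁻¹)         ≈⟨ ∙-congˡ (//-rightDividesʳ x (y ⁻¹)) ⟩
      x ∙ y ⁻¹                        ≈⟨ ∙-congʳ (⁻¹-involutive _) ⟨
      x ⁻¹ ⁻¹ ∙ y ⁻¹                  ∎) (normal Hx (⁻¹∈ x∼y))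

    ∼-pow : ∀ {x y} k → H x → x ∼ y → pow G x k ∼ pow G y k
    ∼-pow zero    _  _   = ∼-refl
    ∼-pow (suc k) Hx x∼y = ∼-∙ (pow∈ H-sub k Hx) x∼y (∼-pow k Hx x∼y)

    ∼-cancelˡ : ∀ {a b x y} → H a → H x → a ∼ b → a ∙ x ∼ b ∙ y → x ∼ y
    ∼-cancelˡ {a} {b} {x} {y} Ha Hx a∼b =
      ∼-resp-≈ (\\-leftDividesʳ a x) (\\-leftDividesʳ b y) ∘ ∼-∙ (H.∙∈ Ha Hx) (∼-⁻¹ Ha a∼b)

    ∼-cancelʳ : ∀ {a b x y} → H x → H a → x ∙ a ∼ y ∙ b → a ∼ b → x ∼ y
    ∼-cancelʳ {a} {b} {x} {y} Hx Ha xa∼yb a∼b =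
      ∼-resp-≈ (//-rightDividesʳ a x) (//-rightDividesʳ b y) (∼-∙ (H.⁻¹∈ Ha) xa∼yb (∼-⁻¹ Ha a∼b))

    ∼-pow-* : ∀ {x y} i j → H x → pow G x j ∼ pow G y j → pow G x (i * j) ∼ pow G y (i * j)
    ∼-pow-* {x} {y} i j Hx =
      ∼-resp-≈ (sym (pow-* x i j)) (sym (pow-* y i j)) ∘ ∼-pow i (pow∈ H-sub j Hx)

    pow-∼-suc-cancel : ∀ {x y} i j → suc i ≡ j → H x →
      pow G x j ∼ pow G y j → pow G x i ∼ pow G y i → x ∼ y
    pow-∼-suc-cancel i _ ≡.refl Hx = ∼-cancelʳ Hx (pow∈ H-sub i Hx)

    pow-∼-coprime : ∀ {n M x y} → Coprime n M → H x →
      pow G x n ∼ pow G y n → pow G x M ∼ pow G y M → x ∼ y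
    pow-∼-coprime {n} {M} n⊥M Hx xⁿ∼yⁿ xᴹ∼yᴹ with coprime-Bézout n⊥M
    ... | Bézout.+- α β eq = pow-∼-suc-cancel (β * M) (α * n) eq Hx (∼-pow-* α n Hx xⁿ∼yⁿ) (∼-pow-* β M Hx xᴹ∼yᴹ)
    ... | Bézout.-+ α β eq = pow-∼-suc-cancel (α * n) (β * M) eq Hx (∼-pow-* β M Hx xᴹ∼yᴹ) (∼-pow-* α n Hx xⁿ∼yⁿ)

module _ {c ℓ p : Level} (G : Group c ℓ) {K H : Group.Carrier G → Set p}
  (K-sub : IsSubgroup G K) (H-sub : IsSubgroup G H) where
  open Congruence G K K-sub
  open Powers G

  pow∈-of-finite-index : ∀ {m} → IndexIn G K H m → ∀ {x} → H x →
    ∃[ d ] (0 < d × d ≤ m × K (pow G x d))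
  pow∈-of-finite-index {m} (r , _ , cover , _) {x} Hx
    with pigeonhole (ℕ.n<1+n m) (λ i → proj₁ (cover (pow∈ H-sub (Fin.toℕ i) Hx)))
  ... | i , j , i<j , same-coset =
    J ∸ I , ℕ.m<n⇒0<n∸m i<j , ℕ.≤-trans (ℕ.m∸n≤m J I) (ℕ.≤-pred (toℕ<n j)) ,
    pow-∼⇒pow-∸∈ I J (ℕ.<⇒≤ i<j) (∼-trans (∼-sym rxᴵ) rxᴶ)
    where
    I J : ℕ
    I = Fin.toℕ i
    J = Fin.toℕ j
    rxᴵ : r (proj₁ (cover (pow∈ H-sub J Hx))) ∼ pow G x I
    rxᴵ = ≡.subst (λ q → r q ∼ pow G x I) same-coset (proj₂ (cover (pow∈ H-sub I Hx)))
    rxᴶ : r (proj₁ (cover (pow∈ H-sub J Hx))) ∼ pow G x J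
    rxᴶ = proj₂ (cover (pow∈ H-sub J Hx))

module FreeQuotient {c ℓ p : Level} (G : Group c ℓ) (N K B : Group.Carrier G → Set p)
  (N-sub : IsSubgroup G N) (K-sub : IsSubgroup G K) (normal : NormalIn G N K)
  (free : IsFreeModOn G N K B) where
  open Group G
  open GroupProperties G
  open Powers G
  open Congruence G N N-sub
  open Normal K K-sub normal
  open import Relation.Binary.Reasoning.Setoid setoid
  private
    module K = IsSubgroup K-sub
    B⊆K : _⊆_ G B K
    B⊆K = proj₁ free
    represented : ∀ {k} → K k → ∃[ w ] (Letters G B w × ReducedMod G N w × k ∼ eval G w)
    represented = proj₁ (proj₂ free)
    independent : ∀ x w → Letters G B (x ∷ w) → ReducedMod G N (x ∷ w) → ¬ N (eval G (x ∷ w))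
    independent = proj₂ (proj₂ free)

  Letter : Set c
  Letter = Carrier × Bool

  Word : Set c
  Word = List Letter

  ⟦_⟧ˡ : Letter → Carrier
  ⟦_⟧ˡ = letter G

  ⟦_⟧ : Word → Carrier
  ⟦_⟧ = eval G

  Basic : Letter → Set p
  Basic (b , _) = B b

  _⁻¹ˡ : Letter → Letter
  (b , s) ⁻¹ˡ = (b , not s)

  infix 4 _≃_ _≃*_
  _≃_ : Letter → Letter → Set p
  (b , s) ≃ (b′ , s′) = s ≡ s′ × b ∼ b′

  _≃*_ : Word → Word → Set (c ⊔ p)
  _≃*_ = Pointwise _≃_

  Cancels : Letter → Letter → Set p
  Cancels (b , s) (b′ , s′) = s′ ≡ not s × b ∼ b′

  Reduced : Word → Set p
  Reduced = ReducedMod G N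

  letter∈K : ∀ {x} → Basic x → K ⟦ x ⟧ˡ
  letter∈K {_ , true}  Bb = B⊆K Bb
  letter∈K {_ , false} Bb = K.⁻¹∈ (B⊆K Bb)

  eval∈K : ∀ {w} → All Basic w → K ⟦ w ⟧
  eval∈K []                = K.ε∈
  eval∈K {x ∷ _} (Bx ∷ Bw) = K.∙∈ (letter∈K {x} Bx) (eval∈K Bw)

  eval-++ : ∀ v w → ⟦ v ++ w ⟧ ≈ ⟦ v ⟧ ∙ ⟦ w ⟧
  eval-++ []      w = sym (identityˡ _)
  eval-++ (x ∷ v) w = trans (∙-congˡ (eval-++ v w)) (sym (assoc _ _ _))

  eval-∷ʳ : ∀ v x → ⟦ v ∷ʳ x ⟧ ≈ ⟦ v ⟧ ∙ ⟦ x ⟧ˡ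
  eval-∷ʳ v x = trans (eval-++ v (x ∷ [])) (∙-congˡ (identityʳ _))

  letter-⁻¹ˡ : ∀ x → ⟦ x ⁻¹ˡ ⟧ˡ ≈ ⟦ x ⟧ˡ ⁻¹
  letter-⁻¹ˡ (_ , true)  = refl
  letter-⁻¹ˡ (_ , false) = sym (⁻¹-involutive _)

  letter-cong : ∀ {x y} → Basic x → x ≃ y → ⟦ x ⟧ˡ ∼ ⟦ y ⟧ˡ
  letter-cong {_ , true}  _  (≡.refl , b∼b′) = b∼b′
  letter-cong {_ , false} Bb (≡.refl , b∼b′) = ∼-⁻¹ (B⊆K Bb) b∼b′

  eval-cong : ∀ {v w} → All Basic v → v ≃* w → ⟦ v ⟧ ∼ ⟦ w ⟧
  eval-cong []                []            = ∼-refl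
  eval-cong {x ∷ _} (Bx ∷ Bv) (x≃y ∷ v≃w) = ∼-∙ (eval∈K Bv) (letter-cong {x} Bx x≃y) (eval-cong Bv v≃w)

  letters : ∀ {w} → All Basic w → Letters G B w
  letters []        = lift tt
  letters (Bx ∷ Bw) = Bx , letters Bw

  basic : ∀ {w} → Letters G B w → All Basic w
  basic {[]}    _         = []
  basic {_ ∷ _} (Bx , Bw) = Bx ∷ basic Bw

  reduced∈N⇒[] : ∀ {w} → All Basic w → Reduced w → N ⟦ w ⟧ → w ≡ []
  reduced∈N⇒[] {[]}    _  _ _  = ≡.refl
  reduced∈N⇒[] {x ∷ w} Bw r Nw = ⊥-elim (independent x w (letters Bw) r Nw)

  -- Freeness makes N decidable on K: k ∈ N iff its reduced representative is empty.
  ∈N? : ∀ {k} → K k → Dec (N k)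
  ∈N? Kk with represented Kk
  ... | []    , _  , _ , k∼ε = yes (∼ε⇒∈ k∼ε)
  ... | x ∷ w , Lw , r , k∼w =
    no λ Nk → independent x w Lw r (N.resp (\\-leftDividesˡ _ _) (N.∙∈ Nk k∼w))
    where module N = IsSubgroup N-sub

  ∼-dec : ∀ {b b′} → B b → B b′ → Dec (b ∼ b′)
  ∼-dec Bb Bb′ = ∈N? (K.∙∈ (K.⁻¹∈ (B⊆K Bb)) (B⊆K Bb′))

  ≃-dec : ∀ {x y} → Basic x → Basic y → Dec (x ≃ y)
  ≃-dec {_ , s} {_ , s′} Bx By = (s Bool.≟ s′) ×-dec ∼-dec Bx By

  Cancels-dec : ∀ {x y} → Basic x → Basic y → Dec (Cancels x y)
  Cancels-dec {_ , s} {_ , s′} Bx By = (s′ Bool.≟ not s) ×-dec ∼-dec Bx By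

  ≃-refl : ∀ {x} → x ≃ x
  ≃-refl = ≡.refl , ∼-refl

  ≃-sym : ∀ {x y} → x ≃ y → y ≃ x
  ≃-sym (s≡s′ , b∼b′) = ≡.sym s≡s′ , ∼-sym b∼b′

  ≃*-refl : ∀ {w} → w ≃* w
  ≃*-refl = Pointwise.refl ≃-refl

  ≃*-sym : ∀ {v w} → v ≃* w → w ≃* v
  ≃*-sym = Pointwise.symmetric ≃-sym

  ≃*-++⁻ : ∀ {v v′ w w′} → length v ≡ length v′ → v ++ w ≃* v′ ++ w′ → v ≃* v′ × w ≃* w′
  ≃*-++⁻ {[]}    {[]}    _   w≃w′        = [] , w≃w′
  ≃*-++⁻ {x ∷ v} {y ∷ v′} |v| (x≃y ∷ rest) =
    let v≃v′ , w≃w′ = ≃*-++⁻ (ℕ.suc-injective |v|) rest in (x≃y ∷ v≃v′) , w≃w′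

  Cancels-irrefl : ∀ x → ¬ Cancels x x
  Cancels-irrefl (_ , true)  (() , _)
  Cancels-irrefl (_ , false) (() , _)

  Cancels-resp : ∀ {x x′ y y′} → x ≃ x′ → y ≃ y′ → Cancels x′ y′ → Cancels x y
  Cancels-resp (≡.refl , b∼b′) (≡.refl , c∼c′) (s , b′∼c′) = s , ∼-trans b∼b′ (∼-trans b′∼c′ (∼-sym c∼c′))

  Cancels-⁻¹ : ∀ {x y} → Cancels (y ⁻¹ˡ) (x ⁻¹ˡ) → Cancels x y
  Cancels-⁻¹ {_ , s} (s≡ , c∼b) = ≡.sym (≡.trans s≡ (Bool.not-involutive _)) , ∼-sym c∼b

  ¬Cancels-⁻¹ˡ : ∀ {x y} → ¬ x ≃ y → ¬ Cancels (x ⁻¹ˡ) y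
  ¬Cancels-⁻¹ˡ x≄y (s , b∼c) = x≄y (≡.sym (≡.trans s (Bool.not-involutive _)) , b∼c)

  CancelFreeˡ : Letter → Word → Set p
  CancelFreeˡ x []      = Lift p ⊤
  CancelFreeˡ x (y ∷ _) = ¬ Cancels x y

  lastOf : Letter → Word → Letter
  lastOf x []      = x
  lastOf _ (y ∷ w) = lastOf y w

  CancelFree : Word → Word → Set p
  CancelFree []      _ = Lift p ⊤
  CancelFree (x ∷ v) w = CancelFreeˡ (lastOf x v) w

  CyclicallyReduced : Word → Set p
  CyclicallyReduced w = CancelFree w w

  lastOf-++ : ∀ x v y w → lastOf x (v ++ y ∷ w) ≡ lastOf y w
  lastOf-++ x []      y w = ≡.refl
  lastOf-++ x (z ∷ v) y w = lastOf-++ z v y w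

  lastOf-cong : ∀ {x y v w} → x ≃ y → v ≃* w → lastOf x v ≃ lastOf y w
  lastOf-cong x≃y []            = x≃y
  lastOf-cong _   (x≃y ∷ v≃w) = lastOf-cong x≃y v≃w

  CancelFree-∷ʳ : ∀ v x {w} → CancelFreeˡ x w → CancelFree (v ∷ʳ x) w
  CancelFree-∷ʳ []      x cf = cf
  CancelFree-∷ʳ (y ∷ v) x {w} cf = ≡.subst (λ z → CancelFreeˡ z w) (≡.sym (lastOf-++ y v x [])) cf

  CancelFreeˡ-resp : ∀ {x x′ w w′} → x ≃ x′ → w ≃* w′ → CancelFreeˡ x w → CancelFreeˡ x′ w′
  CancelFreeˡ-resp x≃x′ []            _  = lift tt
  CancelFreeˡ-resp x≃x′ (y≃y′ ∷ _) cf = cf ∘ Cancels-resp x≃x′ y≃y′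

  reduced-∷ : ∀ {x} w → CancelFreeˡ x w → Reduced w → Reduced (x ∷ w)
  reduced-∷ []      _  _ = lift tt
  reduced-∷ (_ ∷ _) cf r = cf , r

  reduced-head : ∀ {x} w → Reduced (x ∷ w) → CancelFreeˡ x w
  reduced-head []      _ = lift tt
  reduced-head (_ ∷ _) r = proj₁ r

  reduced-tail : ∀ {x} w → Reduced (x ∷ w) → Reduced w
  reduced-tail []      _ = lift tt
  reduced-tail (_ ∷ _) r = proj₂ r

  reduced-++ : ∀ v {w} → Reduced v → Reduced w → CancelFree v w → Reduced (v ++ w)
  reduced-++ []          _  rw _  = rw
  reduced-++ (x ∷ [])    {w} _  rw cf = reduced-∷ w cf rw
  reduced-++ (x ∷ y ∷ v) rv rw cf = proj₁ rv , reduced-++ (y ∷ v) (proj₂ rv) rw cf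

  reduced-++⁻ : ∀ v {w} → Reduced (v ++ w) → Reduced v × CancelFree v w
  reduced-++⁻ []          _ = lift tt , lift tt
  reduced-++⁻ (x ∷ [])    {w} r = lift tt , reduced-head w r
  reduced-++⁻ (x ∷ y ∷ v) r =
    let rv , cf = reduced-++⁻ (y ∷ v) (proj₂ r) in (proj₁ r , rv) , cf

  reduced-resp : ∀ {v w} → v ≃* w → Reduced v → Reduced w
  reduced-resp []                  r = r
  reduced-resp {_ ∷ v} {_ ∷ w} (x≃y ∷ v≃w) r =
    reduced-∷ w (CancelFreeˡ-resp x≃y v≃w (reduced-head v r)) (reduced-resp v≃w (reduced-tail v r))

  _⁻¹ʷ : Word → Word
  []      ⁻¹ʷ = []
  (x ∷ w) ⁻¹ʷ = w ⁻¹ʷ ∷ʳ x ⁻¹ˡ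

  basic-⁻¹ʷ : ∀ {w} → All Basic w → All Basic (w ⁻¹ʷ)
  basic-⁻¹ʷ []        = []
  basic-⁻¹ʷ (Bx ∷ Bw) = All.∷ʳ⁺ (basic-⁻¹ʷ Bw) Bx

  eval-⁻¹ʷ : ∀ w → ⟦ w ⁻¹ʷ ⟧ ≈ ⟦ w ⟧ ⁻¹
  eval-⁻¹ʷ []      = sym ε⁻¹≈ε
  eval-⁻¹ʷ (x ∷ w) = begin
    ⟦ w ⁻¹ʷ ∷ʳ x ⁻¹ˡ ⟧      ≈⟨ eval-∷ʳ (w ⁻¹ʷ) (x ⁻¹ˡ) ⟩
    ⟦ w ⁻¹ʷ ⟧ ∙ ⟦ x ⁻¹ˡ ⟧ˡ  ≈⟨ ∙-cong (eval-⁻¹ʷ w) (letter-⁻¹ˡ x) ⟩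
    ⟦ w ⟧ ⁻¹ ∙ ⟦ x ⟧ˡ ⁻¹    ≈⟨ ⁻¹-anti-homo-∙ _ _ ⟨
    (⟦ x ⟧ˡ ∙ ⟦ w ⟧) ⁻¹     ∎

  reduced-⁻¹ʷ : ∀ w → Reduced w → Reduced (w ⁻¹ʷ)
  reduced-⁻¹ʷ []          r = r
  reduced-⁻¹ʷ (x ∷ [])    r = lift tt
  reduced-⁻¹ʷ (x ∷ y ∷ w) r =
    reduced-++ ((y ∷ w) ⁻¹ʷ) (reduced-⁻¹ʷ (y ∷ w) (proj₂ r)) (lift tt)
      (CancelFree-∷ʳ (w ⁻¹ʷ) (y ⁻¹ˡ) (proj₁ r ∘ Cancels-⁻¹))

  reduced-unique : ∀ v w → All Basic v → All Basic w → Reduced v → Reduced w → ⟦ v ⟧ ∼ ⟦ w ⟧ → v ≃* w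
  reduced-unique [] [] _ _ _ _ _ = []
  reduced-unique [] (y ∷ w) _ Bw _ rw ε∼w with reduced∈N⇒[] Bw rw (ε∼⇒∈ ε∼w)
  ... | ()
  reduced-unique (x ∷ v) [] Bv _ rv _ v∼ε with reduced∈N⇒[] Bv rv (∼ε⇒∈ v∼ε)
  ... | ()
  reduced-unique (x ∷ v) (y ∷ w) (Bx ∷ Bv) (By ∷ Bw) rv rw v∼w with ≃-dec {x} {y} Bx By
  ... | yes x≃y = x≃y ∷ reduced-unique v w Bv Bw (reduced-tail v rv) (reduced-tail w rw)
                    (∼-cancelˡ (letter∈K {x} Bx) (eval∈K Bv) (letter-cong {x} Bx x≃y) v∼w)
  -- Otherwise (x ∷ v)⁻¹ (y ∷ w) is still reduced, and it lies in N.
  ... | no x≄y = ⊥-elim (nonempty (List.++-conicalʳ _ (y ∷ w) (reduced∈N⇒[] Bu ru Nu)))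
    where
    u : Word
    u = (x ∷ v) ⁻¹ʷ ++ y ∷ w
    Bu : All Basic u
    Bu = All.++⁺ (basic-⁻¹ʷ (Bx ∷ Bv)) (By ∷ Bw)
    ru : Reduced u
    ru = reduced-++ ((x ∷ v) ⁻¹ʷ) (reduced-⁻¹ʷ (x ∷ v) rv) rw
           (CancelFree-∷ʳ (v ⁻¹ʷ) (x ⁻¹ˡ) (¬Cancels-⁻¹ˡ x≄y))
    Nu : N ⟦ u ⟧
    Nu = IsSubgroup.resp N-sub (sym (trans (eval-++ ((x ∷ v) ⁻¹ʷ) (y ∷ w)) (∙-congʳ (eval-⁻¹ʷ (x ∷ v))))) v∼w
    nonempty : y ∷ w ≢ []
    nonempty ()

  ⁻¹ˡ-cong : ∀ {x y} → x ≃ y → x ⁻¹ˡ ≃ y ⁻¹ˡ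
  ⁻¹ˡ-cong (s≡s′ , b∼b′) = ≡.cong not s≡s′ , b∼b′

  ⁻¹ˡ-cancel : ∀ {x y} → x ⁻¹ˡ ≃ y ⁻¹ˡ → x ≃ y
  ⁻¹ˡ-cancel (s≡s′ , b∼b′) = Bool.not-injective s≡s′ , b∼b′

  conjugateBy : Word → Word → Word
  conjugateBy []      M = M
  conjugateBy (z ∷ d) M = z ⁻¹ˡ ∷ (conjugateBy d M ∷ʳ z)

  _^ʷ_ : Word → ℕ → Word
  M ^ʷ zero  = []
  M ^ʷ suc k = M ++ M ^ʷ k

  basic-conjugateBy : ∀ {d M} → All Basic d → All Basic M → All Basic (conjugateBy d M)
  basic-conjugateBy []        BM = BM
  basic-conjugateBy (Bz ∷ Bd) BM = Bz ∷ All.∷ʳ⁺ (basic-conjugateBy Bd BM) Bz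

  basic-^ʷ : ∀ {M} k → All Basic M → All Basic (M ^ʷ k)
  basic-^ʷ zero    _  = []
  basic-^ʷ (suc k) BM = All.++⁺ BM (basic-^ʷ k BM)

  ≃*-conjugateBy : ∀ {d d′ M M′} → d ≃* d′ → M ≃* M′ → conjugateBy d M ≃* conjugateBy d′ M′
  ≃*-conjugateBy []            M≃M′ = M≃M′
  ≃*-conjugateBy (z≃z′ ∷ d≃d′) M≃M′ =
    ⁻¹ˡ-cong z≃z′ ∷ Pointwise.++⁺ (≃*-conjugateBy d≃d′ M≃M′) (z≃z′ ∷ [])

  eval-^ʷ : ∀ M k → ⟦ M ^ʷ k ⟧ ≈ pow G ⟦ M ⟧ k
  eval-^ʷ M zero    = refl
  eval-^ʷ M (suc k) = trans (eval-++ M (M ^ʷ k)) (∙-congˡ (eval-^ʷ M k))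

  eval-conjugateBy-∷ : ∀ z d M → ⟦ conjugateBy (z ∷ d) M ⟧ ≈ ⟦ z ⟧ˡ ⁻¹ ∙ (⟦ conjugateBy d M ⟧ ∙ ⟦ z ⟧ˡ)
  eval-conjugateBy-∷ z d M = ∙-cong (letter-⁻¹ˡ z) (eval-∷ʳ (conjugateBy d M) z)

  pow-conjugateBy : ∀ d M k → pow G ⟦ conjugateBy d M ⟧ k ≈ ⟦ conjugateBy d (M ^ʷ k) ⟧
  pow-conjugateBy []      M k = sym (eval-^ʷ M k)
  pow-conjugateBy (z ∷ d) M k = begin
    pow G ⟦ conjugateBy (z ∷ d) M ⟧ k                    ≈⟨ pow-cong k (eval-conjugateBy-∷ z d M) ⟩
    pow G (⟦ z ⟧ˡ ⁻¹ ∙ (⟦ conjugateBy d M ⟧ ∙ ⟦ z ⟧ˡ)) k   ≈⟨ pow-conjugate ⟦ z ⟧ˡ _ k ⟩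
    ⟦ z ⟧ˡ ⁻¹ ∙ (pow G ⟦ conjugateBy d M ⟧ k ∙ ⟦ z ⟧ˡ)   ≈⟨ ∙-congˡ (∙-congʳ (pow-conjugateBy d M k)) ⟩
    ⟦ z ⟧ˡ ⁻¹ ∙ (⟦ conjugateBy d (M ^ʷ k) ⟧ ∙ ⟦ z ⟧ˡ)     ≈⟨ eval-conjugateBy-∷ z d (M ^ʷ k) ⟨
    ⟦ conjugateBy (z ∷ d) (M ^ʷ k) ⟧                     ∎

  record CyclicDecomposition (w : Word) : Set (c ⊔ p) where
    field
      conjugator core : Word
      basic-conjugator : All Basic conjugator
      basic-core       : All Basic core
      ≃*-conjugate     : w ≃* conjugateBy conjugator core
      cyclic           : CyclicallyReduced core

  -- Peel off the first and last letters while they cancel.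
  cyclicDecomposition : ∀ fuel w → length w ≤ fuel → All Basic w → CyclicDecomposition w
  cyclicDecomposition _ [] _ _ = record
    { conjugator = [] ; core = [] ; basic-conjugator = [] ; basic-core = []
    ; ≃*-conjugate = [] ; cyclic = lift tt }
  cyclicDecomposition zero (_ ∷ _) () _
  cyclicDecomposition (suc fuel) (x ∷ t) (s≤s |t|≤fuel) (Bx ∷ Bt) with initLast t
  ... | [] = record
    { conjugator = [] ; core = x ∷ [] ; basic-conjugator = [] ; basic-core = Bx ∷ []
    ; ≃*-conjugate = ≃*-refl ; cyclic = Cancels-irrefl x }
  ... | m ∷ʳ′ y with All.++⁻ m Bt
  ...   | Bm , By ∷ [] with Cancels-dec {y} {x} By Bx
  ...     | no y≭x = record
    { conjugator = [] ; core = x ∷ m ∷ʳ y ; basic-conjugator = [] ; basic-core = Bx ∷ Bt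
    ; ≃*-conjugate = ≃*-refl
    ; cyclic = ≡.subst (λ z → ¬ Cancels z x) (≡.sym (lastOf-++ x m y [])) y≭x }
  ...     | yes (s , y∼x) = record
    { conjugator = y ∷ conjugator ; core = core
    ; basic-conjugator = By ∷ basic-conjugator ; basic-core = basic-core
    ; ≃*-conjugate = (s , ∼-sym y∼x) ∷ Pointwise.++⁺ ≃*-conjugate (≃-refl ∷ [])
    ; cyclic = cyclic }
    where
    open CyclicDecomposition
      (cyclicDecomposition fuel m (ℕ.m+n≤o⇒m≤o (length m) (≡.subst (_≤ fuel) (List.length-++ m) |t|≤fuel)) Bm)

  []-^ʷ : ∀ k → [] ^ʷ k ≡ []
  []-^ʷ zero    = ≡.refl
  []-^ʷ (suc k) = []-^ʷ k

  lastOf-^ʷ : ∀ x w k → lastOf x (w ++ (x ∷ w) ^ʷ k) ≡ lastOf x w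
  lastOf-^ʷ x w zero    = ≡.cong (lastOf x) (List.++-identityʳ w)
  lastOf-^ʷ x w (suc k) = ≡.trans (lastOf-++ x w x (w ++ (x ∷ w) ^ʷ k)) (lastOf-^ʷ x w k)

  cyclicallyReduced-^ʷ : ∀ M k → CyclicallyReduced M → CyclicallyReduced (M ^ʷ suc k)
  cyclicallyReduced-^ʷ []      k _ rewrite []-^ʷ k = lift tt
  cyclicallyReduced-^ʷ (x ∷ w) k c rewrite lastOf-^ʷ x w k = c

  reduced-^ʷ : ∀ x w k → Reduced (x ∷ w) → CyclicallyReduced (x ∷ w) → Reduced ((x ∷ w) ^ʷ suc k)
  reduced-^ʷ x w zero    r c = reduced-++ (x ∷ w) r (lift tt) (lift tt)
  reduced-^ʷ x w (suc k) r c = reduced-++ (x ∷ w) r (reduced-^ʷ x w k r c) c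

  -- v cancels with its neighbours no more than v′ (in use, they share first and last letters).
  SameEnds : Word → Word → Set (c ⊔ p)
  SameEnds v v′ = (∀ x w → CancelFreeˡ x (v′ ++ w) → CancelFreeˡ x (v ++ w))
                × (∀ w → CancelFree v′ w → CancelFree v w)

  sameEnds-conjugateBy-^ʷ : ∀ d x w k → SameEnds (conjugateBy d ((x ∷ w) ^ʷ suc k)) (conjugateBy d (x ∷ w))
  sameEnds-conjugateBy-^ʷ []      x w k = (λ _ _ cf → cf) ,
    λ v cf → ≡.subst (λ z → CancelFreeˡ z v) (≡.sym (lastOf-^ʷ x w k)) cf
  sameEnds-conjugateBy-^ʷ (z ∷ d) x w k = (λ _ _ cf → cf) , λ v cf →
    ≡.subst (λ y → CancelFreeˡ y v) (≡.sym (lastOf-++ (z ⁻¹ˡ) (conjugateBy d ((x ∷ w) ^ʷ suc k)) z []))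
      (≡.subst (λ y → CancelFreeˡ y v) (lastOf-++ (z ⁻¹ˡ) (conjugateBy d (x ∷ w)) z []) cf)

  reduced-conjugateBy-^ʷ : ∀ d M k → Reduced (conjugateBy d M) → CyclicallyReduced M →
    Reduced (conjugateBy d (M ^ʷ suc k))
  reduced-conjugateBy-^ʷ d       []      k r _ rewrite []-^ʷ k = r
  reduced-conjugateBy-^ʷ []      (x ∷ w) k r c = reduced-^ʷ x w k r c
  reduced-conjugateBy-^ʷ (z ∷ d) (x ∷ w) k r c =
    reduced-∷ (conjugateBy d Mᵏ ∷ʳ z) (proj₁ same (z ⁻¹ˡ) (z ∷ []) (reduced-head (conjugateBy d M ∷ʳ z) r))
      (reduced-++ (conjugateBy d Mᵏ) (reduced-conjugateBy-^ʷ d M k (proj₁ inner) c) (lift tt) (proj₂ same (z ∷ []) (proj₂ inner)))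
    where
    M Mᵏ : Word
    M = x ∷ w
    Mᵏ = M ^ʷ suc k
    same : SameEnds (conjugateBy d Mᵏ) (conjugateBy d M)
    same = sameEnds-conjugateBy-^ʷ d x w k
    inner : Reduced (conjugateBy d M) × CancelFree (conjugateBy d M) (z ∷ [])
    inner = reduced-++⁻ (conjugateBy d M) (reduced-tail (conjugateBy d M ∷ʳ z) r)

  conjugate-not-cyclicallyReduced : ∀ {X} z d Y → X ≃* conjugateBy (z ∷ d) Y → ¬ CyclicallyReduced X
  conjugate-not-cyclicallyReduced {x ∷ w} z d Y (x≃z⁻¹ ∷ w≃) cyclic = cyclic (Cancels-resp last≃z x≃z⁻¹ z-cancels)
    where
    last≃z : lastOf x w ≃ z
    last≃z = ≡.subst (lastOf x w ≃_) (lastOf-++ (z ⁻¹ˡ) (conjugateBy d Y) z []) (lastOf-cong x≃z⁻¹ w≃)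
    z-cancels : Cancels z (z ⁻¹ˡ)
    z-cancels = ≡.refl , ∼-refl

  conjugateBy-cancel : ∀ d₁ d₂ {M₁ M₂} → conjugateBy d₁ M₁ ≃* conjugateBy d₂ M₂ →
    CyclicallyReduced M₁ → CyclicallyReduced M₂ → d₁ ≃* d₂ × M₁ ≃* M₂
  conjugateBy-cancel []        []        eq _  _  = [] , eq
  conjugateBy-cancel []        (z ∷ d₂) {_} {M₂} eq c₁ _ =
    ⊥-elim (conjugate-not-cyclicallyReduced z d₂ M₂ eq c₁)
  conjugateBy-cancel (z ∷ d₁) []        {M₁} eq _ c₂ =
    ⊥-elim (conjugate-not-cyclicallyReduced z d₁ M₁ (≃*-sym eq) c₂)
  conjugateBy-cancel (z₁ ∷ d₁) (z₂ ∷ d₂) {M₁} {M₂} (z₁≃z₂ ∷ eq) c₁ c₂ =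
    let d₁≃d₂ , M₁≃M₂ = conjugateBy-cancel d₁ d₂ (proj₁ (≃*-++⁻ same-length eq)) c₁ c₂
    in (⁻¹ˡ-cancel z₁≃z₂ ∷ d₁≃d₂) , M₁≃M₂
    where
    same-length : length (conjugateBy d₁ M₁) ≡ length (conjugateBy d₂ M₂)
    same-length = ℕ.suc-injective (≡.trans (≡.sym (length-∷ʳ (conjugateBy d₁ M₁) z₁))
      (≡.trans (Pointwise-length eq) (length-∷ʳ (conjugateBy d₂ M₂) z₂)))

  length-^ʷ : ∀ M k → length (M ^ʷ k) ≡ k * length M
  length-^ʷ M zero    = ≡.refl
  length-^ʷ M (suc k) = ≡.trans (List.length-++ M) (≡.cong (length M +_) (length-^ʷ M k))

  ^ʷ-cancel : ∀ {M₁ M₂} k → M₁ ^ʷ suc k ≃* M₂ ^ʷ suc k → M₁ ≃* M₂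
  ^ʷ-cancel {M₁} {M₂} k eq = proj₁ (≃*-++⁻ same-length eq)
    where
    same-length : length M₁ ≡ length M₂
    same-length = ℕ.*-cancelˡ-≡ (length M₁) (length M₂) (suc k)
      (≡.trans (≡.sym (length-^ʷ M₁ (suc k))) (≡.trans (Pointwise-length eq) (length-^ʷ M₂ (suc k))))

  record CyclicForm (u : Carrier) : Set (c ⊔ p) where
    field
      conjugator core  : Word
      basic-conjugator : All Basic conjugator
      basic-core       : All Basic core
      reduced          : Reduced (conjugateBy conjugator core)
      cyclic           : CyclicallyReduced core
      represents       : u ∼ ⟦ conjugateBy conjugator core ⟧

  cyclicForm : ∀ {u} → K u → CyclicForm u
  cyclicForm Ku with represented Ku
  ... | w , Lw , rw , u∼w = record
    { conjugator = conjugator ; core = core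
    ; basic-conjugator = basic-conjugator ; basic-core = basic-core
    ; reduced = reduced-resp ≃*-conjugate rw ; cyclic = cyclic
    ; represents = ∼-trans u∼w (eval-cong (basic Lw) ≃*-conjugate) }
    where open CyclicDecomposition (cyclicDecomposition (length w) w ℕ.≤-refl (basic Lw))

  cyclicForm-pow : ∀ {u} k → K u → CyclicForm u → CyclicForm (pow G u (suc k))
  cyclicForm-pow k Ku F = record
    { conjugator = conjugator ; core = core ^ʷ suc k
    ; basic-conjugator = basic-conjugator ; basic-core = basic-^ʷ (suc k) basic-core
    ; reduced = reduced-conjugateBy-^ʷ conjugator core k reduced cyclic
    ; cyclic = cyclicallyReduced-^ʷ core k cyclic
    ; represents = ∼-trans (∼-pow (suc k) Ku represents) (≈⇒∼ (pow-conjugateBy conjugator core (suc k))) }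
    where open CyclicForm F

  cyclicForm-unique : ∀ {u v} (F₁ : CyclicForm u) (F₂ : CyclicForm v) → u ∼ v →
    CyclicForm.conjugator F₁ ≃* CyclicForm.conjugator F₂ × CyclicForm.core F₁ ≃* CyclicForm.core F₂
  cyclicForm-unique F₁ F₂ u∼v = conjugateBy-cancel F₁.conjugator F₂.conjugator
    (reduced-unique _ _ (basic-conjugateBy F₁.basic-conjugator F₁.basic-core)
      (basic-conjugateBy F₂.basic-conjugator F₂.basic-core) F₁.reduced F₂.reduced
      (∼-trans (∼-sym F₁.represents) (∼-trans u∼v F₂.represents)))
    F₁.cyclic F₂.cyclic
    where
    module F₁ = CyclicForm F₁
    module F₂ = CyclicForm F₂

  pow-injective : ∀ {u v} k → K u → K v → pow G u (suc k) ∼ pow G v (suc k) → u ∼ v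
  pow-injective k Ku Kv uᵏ∼vᵏ =
    let d₁≃d₂ , M₁ᵏ≃M₂ᵏ = cyclicForm-unique (cyclicForm-pow k Ku (cyclicForm Ku))
                                            (cyclicForm-pow k Kv (cyclicForm Kv)) uᵏ∼vᵏ
    in ∼-trans F₁.represents
         (∼-trans (eval-cong (basic-conjugateBy F₁.basic-conjugator F₁.basic-core)
                             (≃*-conjugateBy d₁≃d₂ (^ʷ-cancel k M₁ᵏ≃M₂ᵏ)))
                  (∼-sym F₂.represents))
    where
    module F₁ = CyclicForm (cyclicForm Ku)
    module F₂ = CyclicForm (cyclicForm Kv)

module _ {c ℓ p : Level} (G : Group c ℓ) {N H K : Group.Carrier G → Set p}
  (H-sub : IsSubgroup G H) (N-sub : IsSubgroup G N) (K-sub : IsSubgroup G K)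
  (K⊆H : _⊆_ G K H) (normal : NormalIn G N H) where
  open Group G
  open Powers G
  open Congruence G N N-sub
  open Normal H H-sub normal
  private module K = IsSubgroup K-sub

  pow∈-coprime-exponent : ∀ {m n} → IndexIn G K H m → Prime n → m < n → ∀ {x y} → H x → H y →
    ∃[ M ] (Coprime n M × K (pow G x M) × K (pow G y M))
  pow∈-coprime-exponent index n-prime m<n {x} {y} Hx Hy
    with pow∈-of-finite-index G K-sub H-sub index Hx | pow∈-of-finite-index G K-sub H-sub index Hy
  ... | dx , 0<dx , dx≤m , Kxᵈ | dy , 0<dy , dy≤m , Kyᵈ =
    dy * dx ,
    coprime-* (prime⇒coprime n-prime {{>-nonZero 0<dy}} (ℕ.≤-<-trans dy≤m m<n))
              (prime⇒coprime n-prime {{>-nonZero 0<dx}} (ℕ.≤-<-trans dx≤m m<n)) ,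
    K.resp (sym (pow-* x dy dx)) (pow∈ K-sub dy Kxᵈ) ,
    K.resp (trans (sym (pow-* y dx dy)) (reflexive (≡.cong (pow G y) (ℕ.*-comm dx dy)))) (pow∈ K-sub dx Kyᵈ)

  pow-injective-mod : ∀ {B m n} → IsFreeModOn G N K B → IndexIn G K H m → Prime n → m < n →
    ∀ {x y} → H x → H y → pow G x n ≈ pow G y n → x ∼ y
  pow-injective-mod {n = suc k} free index n-prime m<n {x} {y} Hx Hy xⁿ≈yⁿ
    with pow∈-coprime-exponent index n-prime m<n Hx Hy
  ... | M , n⊥M , Kxᴹ , Kyᴹ = pow-∼-coprime n⊥M Hx (≈⇒∼ xⁿ≈yⁿ)
    (FreeQuotient.pow-injective G N K _ N-sub K-sub (normal ∘ K⊆H) free k Kxᴹ Kyᴹ (≈⇒∼ (begin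
      pow G (pow G x M) (suc k) ≈⟨ pow-pow-comm x M (suc k) ⟩
      pow G (pow G x (suc k)) M ≈⟨ pow-cong M xⁿ≈yⁿ ⟩
      pow G (pow G y (suc k)) M ≈⟨ pow-pow-comm y M (suc k) ⟨
      pow G (pow G y M) (suc k) ∎)))
    where open import Relation.Binary.Reasoning.Setoid setoid

lemma4p8 : ∀ {c ℓ p : Level} (G : Group c ℓ) (N H K : Group.Carrier G → Set p) (m : ℕ) →
    IsSubgroup G H → IsSubgroup G N → IsSubgroup G K →
    _⊆_ G N K → _⊆_ G K H → NormalIn G N H →
    VirtuallyFreeNonAbelianMod G N H →
    FreeNonAbelianMod G N K → NormalIn G K H → IndexIn G K H m →
    (∃[ n ] (Prime n × m < n × IsPure G n H)) →
    (∀ n → Prime n → m < n → IsPure G n H → SequenceProperty G n N H) →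
    ∀ n → Prime n → m < n → IsPure G n H →
      ((∀ a → H a → (_⊆_ G (Roots G n a) H × CardMod≤ G N (Roots G n a) 1))
       × SequenceProperty G n N H)
lemma4p8 G N H K m H-sub N-sub K-sub _ K⊆H normal _ ((_ , free) , _) _ index _ sequence n n-prime m<n pure =
  (λ a Ha → roots⊆H Ha , cardMod≤1 λ xⁿ≈a yⁿ≈a →
     pow-injective-mod G H-sub N-sub K-sub K⊆H normal free index n-prime m<n
       (roots⊆H Ha xⁿ≈a) (roots⊆H Ha yⁿ≈a) (trans xⁿ≈a (sym yⁿ≈a))) ,
  sequence n n-prime m<n pure
  where
  open Group G using (trans; sym)
  open Congruence G N N-sub using (cardMod≤1)
  roots⊆H : ∀ {a} → H a → _⊆_ G (Roots G n a) H
  roots⊆H {a} Ha {x} = pure a x Ha
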